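{- For every tame $\mathbf{LK}^{\mathrm{m}}$ proof $\pi$ of a split sequent $\Gamma_1;\Gamma_2\Rightarrow\Delta_1;\Delta_2$ all of whose cuts are of type R, there is an $\mathbf{LK}^-$ proof $\pi'$ of $\Gamma_1;\Gamma_2\Rightarrow\Delta_1;\Delta_2$ such that $\mathrm{CNF}(\mathcal{M}(\pi))$ subsumes $\mathrm{CNF}(\mathcal{M}(\pi'))$.
   Context: Propositional formulas are built from atoms and $\bot$ using $\wedge,\vee,\neg$; $\top$ abbreviates $\neg\bot\vee\bot$. $V(A)$ is the set of atoms of $A$. A literal is an atom (counting $\bot$ as an atom), a negated atom, or $\top$. A clause is a finite set of literals, a clause set a set of clauses. A clause set $\mathcal{A}$ subsumes a clause set $\mathcal{B}$ if for every $B\in\mathcal{B}$ there is $A\in\mathcal{A}$ with $A\subseteq B$. $\mathcal{C}\times\mathcal{D}=\{C\cup D\mid C\in\mathcal{C},D\in\mathcal{D}\}$; $\mathrm{CNF}$ is defined on formulas built from literals by $\wedge,\vee$: $\mathrm{CNF}(\top)=\emptyset$, $\mathrm{CNF}(\bot)=\{\emptyset\}$, $\mathrm{CNF}(\ell)=\{\{\ell\}\}$ for other literals, $\mathrm{CNF}(A\wedge B)=\mathrm{CNF}(A)\cup\mathrm{CNF}(B)$, $\mathrm{CNF}(A\vee B)=\mathrm{CNF}(A)\times\mathrm{CNF}(B)$. $\mathbf{LK}$ is the sequent calculus with axioms $p\Rightarrow p$ ($p$ an atom) and $\bot\Rightarrow$, and rules weakening, contraction, $(L\wedge_1),(L\wedge_2),(R\wedge),(R\vee_1),(R\vee_2),(L\vee),(L\neg),(R\neg)$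 and cut ($\Gamma\Rightarrow\Delta,A$ and $A,\Gamma\Rightarrow\Delta$ / $\Gamma\Rightarrow\Delta$), in standard Gentzen G1 form; $\mathbf{LK}^-$ is $\mathbf{LK}$ without cut. A split sequent $\Gamma_1;\Gamma_2\Rightarrow\Delta_1;\Delta_2$ is the sequent $\Gamma_1,\Gamma_2\Rightarrow\Delta_1,\Delta_2$ with formulas divided into a left side ($\Gamma_1,\Delta_1$) and a right side ($\Gamma_2,\Delta_2$). In a proof of a split sequent every sequent is split, context formulas keep their side, auxiliary formulas lie on the side of the main formula, and both occurrences of a cut formula $A$ lie on one side. $\mathbf{LK}^{\mathrm{m}}$ allows a cut with conclusion $\Gamma_1;\Gamma_2\Rightarrow\Delta_1;\Delta_2$ only if $A$ is on the left side (premises $\Gamma_1;\Gamma_2\Rightarrow\Delta_1,A;\Delta_2$ and $\Gamma_1,A;\Gamma_2\Rightarrow\Delta_1;\Delta_2$) with $V(A)\subseteq V(\Gamma_1\cup\Delta_1)$, or on the right side (premises $\Gamma_1;\Gamma_2\Rightarrow\Delta_1;\Delta_2,A$ and $\Gamma_1;\Gamma_2,A\Rightarrow\Delta_1;\Delta_2$) with $V(A)\subseteq V(\Gamma_2\cup\Delta_2)$; cuts of the latter form are of type R. The Maehara interpolant $\mathcal{M}(\pi)$: axioms $p;\Rightarrow p;$ give $\bot$, $;p\Rightarrow;p$ give $\top$, $p;\Rightarrow;p$ give $p$, $;p\Rightarrow p;$ give $\neg p$, $\bot;\Rightarrow;$ gives $\bot$, $;\bot\Rightarrow;$ gives $\top$;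 unary rules keep the premise's interpolant; a binary rule ($(R\wedge)$, $(L\vee)$, cut) with premise proofs $\pi_1,\pi_2$ gives $\mathcal{M}(\pi_1)\vee\mathcal{M}(\pi_2)$ if its main/cut formula is on the left side and $\mathcal{M}(\pi_1)\wedge\mathcal{M}(\pi_2)$ if on the right side. Ancestors: if $\mu$ is the main formula occurrence of a logical or structural inference and $\nu$ an auxiliary occurrence of it, $\nu$ is a direct ancestor of $\mu$; a context occurrence in a premise is a direct ancestor of the corresponding occurrence in the conclusion; the ancestor relation is the reflexive transitive closure. An axiom is of type R/R if it appears as $;p\Rightarrow;p$. An axiom occurrence $p\Rightarrow p$ is of type $\Omega$ if both its occurrences of $p$ are ancestors of cut-formula occurrences. An $\mathbf{LK}^{\mathrm{m}}$ proof is tame if (1) it contains no axiom of type $\Omega$, and (2) every cut has a premise subproof (left or right) in which all axioms in which an ancestor of that premise's cut-formula occurrence occurs are of type R/R. -}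

module Defs where

open import Data.Nat using (ℕ; zero; suc)
open import Data.List using (List; []; _∷_; _++_; length; concatMap)
open import Data.List.Membership.Propositional using (_∈_)
open import Data.List.Relation.Binary.Subset.Propositional using (_⊆_)
open import Data.Product using (Σ; _×_; _,_)
open import Data.Sum using (_⊎_; inj₁; inj₂)
open import Data.Empty using (⊥)
open import Data.Unit using (⊤)
open import Relation.Binary.PropositionalEquality using (_≡_)
open import Relation.Nullary using (¬_)

data Fm : Set where
  var  : ℕ → Fm
  ⊥'   : Fm
  _∧'_ : Fm → Fm → Fm
  _∨'_ : Fm → Fm → Fm
  ¬'_  : Fm → Fm

vars : Fm → List ℕ
vars (var p)  = p ∷ []
vars ⊥'       = []
vars (A ∧' B) = vars A ++ vars B
vars (A ∨' B) = vars A ++ vars B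
vars (¬' A)   = vars A

-- A split sequent Γ₁;Γ₂ ⇒ Δ₁;Δ₂ is represented as a list
-- of formula occurrences, each tagged with its side (L = left, R = right)
-- and its polarity (ante = antecedent, succ = succedent).
-- Order is immaterial (there is an exchange rule).

data Part : Set where
  L R : Part

data Pol : Set where
  ante succ : Pol

record Entry : Set where
  constructor en
  field
    part : Part
    pol  : Pol
    fm   : Fm

Seq : Set
Seq = List Entry

varsPart : Part → Seq → List ℕ
varsPart k [] = []
varsPart L (en L _ A ∷ Γ) = vars A ++ varsPart L Γ
varsPart L (en R _ A ∷ Γ) = varsPart L Γ
varsPart R (en L _ A ∷ Γ) = varsPart R Γ
varsPart R (en R _ A ∷ Γ) = vars A ++ varsPart R Γ

-- LK proofs of split sequents (G1 style; main formula at the head).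
-- Context formulas keep their side, auxiliary formulas lie on the side of
-- the main formula, both cut-formula occurrences lie on one side.

data Proof : Seq → Set where
  ax   : (k k' : Part) (p : ℕ) → Proof (en k ante (var p) ∷ en k' succ (var p) ∷ [])
  ax⊥  : (k : Part) → Proof (en k ante ⊥' ∷ [])
  wk   : ∀ {Γ} (e : Entry) → Proof Γ → Proof (e ∷ Γ)
  ctr  : ∀ {Γ e} → Proof (e ∷ e ∷ Γ) → Proof (e ∷ Γ)
  exch : ∀ Γ e f Δ → Proof (Γ ++ f ∷ e ∷ Δ) → Proof (Γ ++ e ∷ f ∷ Δ)
  L∧₁  : ∀ {Γ} k A B → Proof (en k ante A ∷ Γ) → Proof (en k ante (A ∧' B) ∷ Γ)
  L∧₂  : ∀ {Γ} k A B → Proof (en k ante B ∷ Γ) → Proof (en k ante (A ∧' B) ∷ Γ)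
  R∧   : ∀ {Γ} k A B → Proof (en k succ A ∷ Γ) → Proof (en k succ B ∷ Γ)
                     → Proof (en k succ (A ∧' B) ∷ Γ)
  R∨₁  : ∀ {Γ} k A B → Proof (en k succ A ∷ Γ) → Proof (en k succ (A ∨' B) ∷ Γ)
  R∨₂  : ∀ {Γ} k A B → Proof (en k succ B ∷ Γ) → Proof (en k succ (A ∨' B) ∷ Γ)
  L∨   : ∀ {Γ} k A B → Proof (en k ante A ∷ Γ) → Proof (en k ante B ∷ Γ)
                     → Proof (en k ante (A ∨' B) ∷ Γ)
  L¬   : ∀ {Γ} k A → Proof (en k succ A ∷ Γ) → Proof (en k ante (¬' A) ∷ Γ)
  R¬   : ∀ {Γ} k A → Proof (en k ante A ∷ Γ) → Proof (en k succ (¬' A) ∷ Γ)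
  cut  : ∀ {Γ} k A → Proof (en k succ A ∷ Γ) → Proof (en k ante A ∷ Γ) → Proof Γ

CutPred : Set₁
CutPred = ∀ {Γ} (k : Part) (A : Fm) → Proof (en k succ A ∷ Γ) → Proof (en k ante A ∷ Γ) → Set

AllCuts : CutPred → ∀ {Γ} → Proof Γ → Set
AllCuts P (ax k k' p) = ⊤
AllCuts P (ax⊥ k) = ⊤
AllCuts P (wk e π) = AllCuts P π
AllCuts P (ctr π) = AllCuts P π
AllCuts P (exch Γ e f Δ π) = AllCuts P π
AllCuts P (L∧₁ k A B π) = AllCuts P π
AllCuts P (L∧₂ k A B π) = AllCuts P π
AllCuts P (R∧ k A B π₁ π₂) = AllCuts P π₁ × AllCuts P π₂
AllCuts P (R∨₁ k A B π) = AllCuts P π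
AllCuts P (R∨₂ k A B π) = AllCuts P π
AllCuts P (L∨ k A B π₁ π₂) = AllCuts P π₁ × AllCuts P π₂
AllCuts P (L¬ k A π) = AllCuts P π
AllCuts P (R¬ k A π) = AllCuts P π
AllCuts P (cut k A π₁ π₂) = P k A π₁ π₂ × AllCuts P π₁ × AllCuts P π₂

CutFree : ∀ {Γ} → Proof Γ → Set
CutFree = AllCuts (λ _ _ _ _ → ⊥)

IsLKm : ∀ {Γ} → Proof Γ → Set
IsLKm = AllCuts (λ {Γ} k A _ _ → vars A ⊆ varsPart k Γ)

AllCutsTypeR : ∀ {Γ} → Proof Γ → Set
AllCutsTypeR = AllCuts (λ k _ _ _ → k ≡ R)

data Leaf : Set where
  varAx : Part → Part → ℕ → Leaf   -- p ⇒ p : side of antecedent p, side of succedent p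
  botAx : Part → Leaf

AxPos : ∀ {Γ} → Proof Γ → Set
AxPos (ax k k' p) = ⊤
AxPos (ax⊥ k) = ⊤
AxPos (wk e π) = AxPos π
AxPos (ctr π) = AxPos π
AxPos (exch Γ e f Δ π) = AxPos π
AxPos (L∧₁ k A B π) = AxPos π
AxPos (L∧₂ k A B π) = AxPos π
AxPos (R∧ k A B π₁ π₂) = AxPos π₁ ⊎ AxPos π₂
AxPos (R∨₁ k A B π) = AxPos π
AxPos (R∨₂ k A B π) = AxPos π
AxPos (L∨ k A B π₁ π₂) = AxPos π₁ ⊎ AxPos π₂
AxPos (L¬ k A π) = AxPos π
AxPos (R¬ k A π) = AxPos π
AxPos (cut k A π₁ π₂) = AxPos π₁ ⊎ AxPos π₂

axAt : ∀ {Γ} (π : Proof Γ) → AxPos π → Leaf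
axAt (ax k k' p) _ = varAx k k' p
axAt (ax⊥ k) _ = botAx k
axAt (wk e π) a = axAt π a
axAt (ctr π) a = axAt π a
axAt (exch Γ e f Δ π) a = axAt π a
axAt (L∧₁ k A B π) a = axAt π a
axAt (L∧₂ k A B π) a = axAt π a
axAt (R∧ k A B π₁ π₂) (inj₁ a) = axAt π₁ a
axAt (R∧ k A B π₁ π₂) (inj₂ a) = axAt π₂ a
axAt (R∨₁ k A B π) a = axAt π a
axAt (R∨₂ k A B π) a = axAt π a
axAt (L∨ k A B π₁ π₂) (inj₁ a) = axAt π₁ a
axAt (L∨ k A B π₁ π₂) (inj₂ a) = axAt π₂ a
axAt (L¬ k A π) a = axAt π a
axAt (R¬ k A π) a = axAt π a
axAt (cut k A π₁ π₂) (inj₁ a) = axAt π₁ a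
axAt (cut k A π₁ π₂) (inj₂ a) = axAt π₂ a

-- index map of an exchange at position n (conclusion index ↦ premise index)
swapIx : ℕ → ℕ → ℕ
swapIx zero zero = suc zero
swapIx zero (suc zero) = zero
swapIx zero (suc (suc i)) = suc (suc i)
swapIx (suc n) zero = zero
swapIx (suc n) (suc i) = suc (swapIx n i)

-- Anc π i a j : the j-th formula occurrence of the axiom occurrence a
-- (index 0 = antecedent p / ⊥, index 1 = succedent p) is an ancestor of
-- the i-th formula occurrence of the end sequent of π.
Anc : ∀ {Γ} (π : Proof Γ) → ℕ → AxPos π → ℕ → Set
Anc (ax k k' p) i _ j = i ≡ j
Anc (ax⊥ k) i _ j = i ≡ j
Anc (wk e π) zero a j = ⊥
Anc (wk e π) (suc i) a j = Anc π i a j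
Anc (ctr π) zero a j = Anc π zero a j ⊎ Anc π (suc zero) a j
Anc (ctr π) (suc i) a j = Anc π (suc (suc i)) a j
Anc (exch Γ e f Δ π) i a j = Anc π (swapIx (length Γ) i) a j
Anc (L∧₁ k A B π) i a j = Anc π i a j
Anc (L∧₂ k A B π) i a j = Anc π i a j
Anc (R∧ k A B π₁ π₂) i (inj₁ a) j = Anc π₁ i a j
Anc (R∧ k A B π₁ π₂) i (inj₂ a) j = Anc π₂ i a j
Anc (R∨₁ k A B π) i a j = Anc π i a j
Anc (R∨₂ k A B π) i a j = Anc π i a j
Anc (L∨ k A B π₁ π₂) i (inj₁ a) j = Anc π₁ i a j
Anc (L∨ k A B π₁ π₂) i (inj₂ a) j = Anc π₂ i a j
Anc (L¬ k A π) i a j = Anc π i a j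
Anc (R¬ k A π) i a j = Anc π i a j
Anc (cut k A π₁ π₂) i (inj₁ a) j = Anc π₁ (suc i) a j
Anc (cut k A π₁ π₂) i (inj₂ a) j = Anc π₂ (suc i) a j

-- CutAnc π a j : the j-th formula occurrence of axiom occurrence a is an
-- ancestor of some cut-formula occurrence (of some cut in π).
CutAnc : ∀ {Γ} (π : Proof Γ) → AxPos π → ℕ → Set
CutAnc (ax k k' p) _ j = ⊥
CutAnc (ax⊥ k) _ j = ⊥
CutAnc (wk e π) a j = CutAnc π a j
CutAnc (ctr π) a j = CutAnc π a j
CutAnc (exch Γ e f Δ π) a j = CutAnc π a j
CutAnc (L∧₁ k A B π) a j = CutAnc π a j
CutAnc (L∧₂ k A B π) a j = CutAnc π a j
CutAnc (R∧ k A B π₁ π₂) (inj₁ a) j = CutAnc π₁ a j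
CutAnc (R∧ k A B π₁ π₂) (inj₂ a) j = CutAnc π₂ a j
CutAnc (R∨₁ k A B π) a j = CutAnc π a j
CutAnc (R∨₂ k A B π) a j = CutAnc π a j
CutAnc (L∨ k A B π₁ π₂) (inj₁ a) j = CutAnc π₁ a j
CutAnc (L∨ k A B π₁ π₂) (inj₂ a) j = CutAnc π₂ a j
CutAnc (L¬ k A π) a j = CutAnc π a j
CutAnc (R¬ k A π) a j = CutAnc π a j
CutAnc (cut k A π₁ π₂) (inj₁ a) j = Anc π₁ zero a j ⊎ CutAnc π₁ a j
CutAnc (cut k A π₁ π₂) (inj₂ a) j = Anc π₂ zero a j ⊎ CutAnc π₂ a j

IsRR : Leaf → Set
IsRR (varAx R R p) = ⊤
IsRR (varAx _ _ p) = ⊥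
IsRR (botAx k) = ⊥

IsVarAx : Leaf → Set
IsVarAx (varAx _ _ _) = ⊤
IsVarAx (botAx _) = ⊥

TypeΩ : ∀ {Γ} (π : Proof Γ) → AxPos π → Set
TypeΩ π a = IsVarAx (axAt π a) × CutAnc π a zero × CutAnc π a (suc zero)

-- every axiom of π in which an ancestor of the end-sequent occurrence with
-- index 0 (the cut-formula occurrence of a cut premise) occurs is of type R/R
CutFmRR : ∀ {Γ} → Proof Γ → Set
CutFmRR π = ∀ (a : AxPos π) (j : ℕ) → Anc π zero a j → IsRR (axAt π a)

Tame : ∀ {Γ} → Proof Γ → Set
Tame π = (∀ (a : AxPos π) → ¬ TypeΩ π a)
       × AllCuts (λ _ _ π₁ π₂ → CutFmRR π₁ ⊎ CutFmRR π₂) π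

data Atom : Set where
  avar  : ℕ → Atom
  afalsum : Atom                    -- ⊥ counted as an atom

data Literal : Set where
  pos : Atom → Literal
  neg : Atom → Literal
  top : Literal

data LF : Set where
  lit  : Literal → LF
  _∧ᴸ_ : LF → LF → LF
  _∨ᴸ_ : LF → LF → LF

Clause : Set
Clause = List Literal

ClauseSet : Set
ClauseSet = List Clause

_×ᶜ_ : ClauseSet → ClauseSet → ClauseSet
𝒞 ×ᶜ 𝒟 = concatMap (λ C → concatMap (λ D → (C ++ D) ∷ []) 𝒟) 𝒞

CNF : LF → ClauseSet
CNF (lit top) = []
CNF (lit (pos afalsum)) = [] ∷ []
CNF (lit ℓ) = (ℓ ∷ []) ∷ []
CNF (A ∧ᴸ B) = CNF A ++ CNF B
CNF (A ∨ᴸ B) = CNF A ×ᶜ CNF B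

Subsumes : ClauseSet → ClauseSet → Set
Subsumes 𝒜 ℬ = ∀ B → B ∈ ℬ → Σ Clause (λ A → A ∈ 𝒜 × A ⊆ B)

⊥ᴸ ⊤ᴸ : LF
⊥ᴸ = lit (pos afalsum)
⊤ᴸ = lit top

binM : Part → LF → LF → LF
binM L A B = A ∨ᴸ B
binM R A B = A ∧ᴸ B

Maehara : ∀ {Γ} → Proof Γ → LF
Maehara (ax L L p) = ⊥ᴸ
Maehara (ax R R p) = ⊤ᴸ
Maehara (ax L R p) = lit (pos (avar p))
Maehara (ax R L p) = lit (neg (avar p))
Maehara (ax⊥ L) = ⊥ᴸ
Maehara (ax⊥ R) = ⊤ᴸ
Maehara (wk e π) = Maehara π
Maehara (ctr π) = Maehara π
Maehara (exch Γ e f Δ π) = Maehara π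
Maehara (L∧₁ k A B π) = Maehara π
Maehara (L∧₂ k A B π) = Maehara π
Maehara (R∧ k A B π₁ π₂) = binM k (Maehara π₁) (Maehara π₂)
Maehara (R∨₁ k A B π) = Maehara π
Maehara (R∨₂ k A B π) = Maehara π
Maehara (L∨ k A B π₁ π₂) = binM k (Maehara π₁) (Maehara π₂)
Maehara (L¬ k A π) = Maehara π
Maehara (R¬ k A π) = Maehara π
Maehara (cut k A π₁ π₂) = binM k (Maehara π₁) (Maehara π₂)

module Submission where

-- Cuts are eliminated innermost first, each by a mix (multicut) elimination that only
-- permutes rules and performs principal reductions.  A type-R cut contributes M₁ ∧ M₂ to
-- the Maehara interpolant, and every reduction step yields an interpolant whose CNF is
-- subsumed by that of M₁ ∧ M₂ — except one: an axiom reduction cutting p;⇒;p against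
-- ;p⇒p; produces p;⇒p; with interpolant ⊥, not bounded by p ∧ ¬p.  Tameness excludes it.
-- Mark an occurrence rr when all axioms it descends from are of type R/R; condition (2)
-- lets us so mark the cut formula in one premise of every cut, and condition (1) ensures
-- that no axiom gets both ends marked.  Then every axiom reduction involves an R/R axiom,
-- whose interpolant ⊤ is neutral for ∧.

open import Defs
open import Data.Empty using (⊥; ⊥-elim)
open import Data.List using (List; []; _∷_; _++_; [_]; concatMap; map; length)
open import Data.List.Membership.Propositional using (_∈_; find; lose)
open import Data.List.Membership.Propositional.Properties
  using (∈-++⁺ˡ; ∈-++⁺ʳ; ∈-++⁻; ∈-concatMap⁺; ∈-concatMap⁻; ∈-∃++)
open import Data.List.Properties using (++-assoc)
open import Data.List.Relation.Binary.Permutation.Propositional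
  using (_↭_; refl; prep; swap; trans; ↭-sym)
open import Data.List.Relation.Binary.Permutation.Propositional.Properties
  using (++-comm; shift; map⁺; ∈-resp-↭)
open import Data.List.Relation.Binary.Subset.Propositional using (_⊆_)
open import Data.List.Relation.Unary.Any using (here; there)
open import Data.Nat using (ℕ; zero; suc)
import Data.Nat as ℕ
open import Data.Product using (Σ; ∃₂; _×_; _,_; proj₁; proj₂; uncurry)
open import Data.Product.Properties using (≡-dec)
open import Data.Sum using (_⊎_; inj₁; inj₂; [_,_]′)
open import Data.Unit using (⊤; tt)
open import Function using (_∘_)
open import Relation.Binary.Definitions using (DecidableEquality)
open import Relation.Binary.PropositionalEquality
  using (_≡_; _≢_; refl; sym; cong; cong₂; subst)
open import Relation.Nullary using (¬_; yes; no)
open import Relation.Nullary.Decidable using (map′; _×-dec_)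

∧'-injective : ∀ {A B A′ B′} → A ∧' B ≡ A′ ∧' B′ → A ≡ A′ × B ≡ B′
∧'-injective refl = refl , refl

∨'-injective : ∀ {A B A′ B′} → A ∨' B ≡ A′ ∨' B′ → A ≡ A′ × B ≡ B′
∨'-injective refl = refl , refl

infix 4 _≟ᶠ_ _≟ᵖ_ _≟ᵒ_ _≟ᵉ_

_≟ᶠ_ : DecidableEquality Fm
var p ≟ᶠ var q = map′ (cong var) (λ { refl → refl }) (p ℕ.≟ q)
⊥' ≟ᶠ ⊥' = yes refl
(A ∧' B) ≟ᶠ (A′ ∧' B′) =
  map′ (uncurry (cong₂ _∧'_)) ∧'-injective (A ≟ᶠ A′ ×-dec B ≟ᶠ B′)
(A ∨' B) ≟ᶠ (A′ ∨' B′) =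
  map′ (uncurry (cong₂ _∨'_)) ∨'-injective (A ≟ᶠ A′ ×-dec B ≟ᶠ B′)
(¬' A) ≟ᶠ (¬' A′) = map′ (cong ¬'_) (λ { refl → refl }) (A ≟ᶠ A′)
var _ ≟ᶠ ⊥' = no λ ()
var _ ≟ᶠ (_ ∧' _) = no λ ()
var _ ≟ᶠ (_ ∨' _) = no λ ()
var _ ≟ᶠ (¬' _) = no λ ()
⊥' ≟ᶠ var _ = no λ ()
⊥' ≟ᶠ (_ ∧' _) = no λ ()
⊥' ≟ᶠ (_ ∨' _) = no λ ()
⊥' ≟ᶠ (¬' _) = no λ ()
(_ ∧' _) ≟ᶠ var _ = no λ ()
(_ ∧' _) ≟ᶠ ⊥' = no λ ()
(_ ∧' _) ≟ᶠ (_ ∨' _) = no λ ()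
(_ ∧' _) ≟ᶠ (¬' _) = no λ ()
(_ ∨' _) ≟ᶠ var _ = no λ ()
(_ ∨' _) ≟ᶠ ⊥' = no λ ()
(_ ∨' _) ≟ᶠ (_ ∧' _) = no λ ()
(_ ∨' _) ≟ᶠ (¬' _) = no λ ()
(¬' _) ≟ᶠ var _ = no λ ()
(¬' _) ≟ᶠ ⊥' = no λ ()
(¬' _) ≟ᶠ (_ ∧' _) = no λ ()
(¬' _) ≟ᶠ (_ ∨' _) = no λ ()

_≟ᵖ_ : DecidableEquality Part
L ≟ᵖ L = yes refl
R ≟ᵖ R = yes refl
L ≟ᵖ R = no λ ()
R ≟ᵖ L = no λ ()

_≟ᵒ_ : DecidableEquality Pol
ante ≟ᵒ ante = yes refl
succ ≟ᵒ succ = yes refl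
ante ≟ᵒ succ = no λ ()
succ ≟ᵒ ante = no λ ()

en-injective : ∀ {k o A k′ o′ A′} → en k o A ≡ en k′ o′ A′ → k ≡ k′ × o ≡ o′ × A ≡ A′
en-injective refl = refl , refl , refl

_≟ᵉ_ : DecidableEquality Entry
en k o A ≟ᵉ en k′ o′ A′ =
  map′ (λ { (refl , refl , refl) → refl }) en-injective (k ≟ᵖ k′ ×-dec o ≟ᵒ o′ ×-dec A ≟ᶠ A′)

infix 4 _⊑_

record _⊑_ (A B : LF) : Set where
  constructor ⊑-intro
  field subsumes : Subsumes (CNF B) (CNF A)
open _⊑_

⊑-refl : ∀ {A} → A ⊑ A
⊑-refl = ⊑-intro λ C C∈ → C , C∈ , λ z → z

⊑-trans : ∀ {A B D} → A ⊑ B → B ⊑ D → A ⊑ D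
⊑-trans (⊑-intro A⊑B) (⊑-intro B⊑D) = ⊑-intro λ C C∈ →
  let C′ , C′∈ , C′⊆C = A⊑B C C∈
      C″ , C″∈ , C″⊆C′ = B⊑D C′ C′∈
  in C″ , C″∈ , C′⊆C ∘ C″⊆C′

CNF⊆⇒⊑ : ∀ {A B} → (∀ {C} → C ∈ CNF A → C ∈ CNF B) → A ⊑ B
CNF⊆⇒⊑ A⊆B = ⊑-intro λ C C∈ → C , A⊆B C∈ , λ z → z

∧-upperˡ : ∀ {A B} → A ⊑ A ∧ᴸ B
∧-upperˡ = CNF⊆⇒⊑ ∈-++⁺ˡ

∧-upperʳ : ∀ {A B} → B ⊑ A ∧ᴸ B
∧-upperʳ {A} = CNF⊆⇒⊑ (∈-++⁺ʳ (CNF A))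

∧-lub : ∀ {A B D} → A ⊑ D → B ⊑ D → A ∧ᴸ B ⊑ D
∧-lub {A} (⊑-intro A⊑D) (⊑-intro B⊑D) =
  ⊑-intro λ C C∈ → [ A⊑D C , B⊑D C ]′ (∈-++⁻ (CNF A) C∈)

∧-mono : ∀ {A A′ B B′} → A ⊑ A′ → B ⊑ B′ → A ∧ᴸ B ⊑ A′ ∧ᴸ B′
∧-mono A⊑A′ B⊑B′ = ∧-lub (⊑-trans A⊑A′ ∧-upperˡ) (⊑-trans B⊑B′ ∧-upperʳ)

∧-comm : ∀ {A B} → A ∧ᴸ B ⊑ B ∧ᴸ A
∧-comm = ∧-lub ∧-upperʳ ∧-upperˡ

∈-×ᶜ⁺ : ∀ {U D 𝒞 𝒟} → U ∈ 𝒞 → D ∈ 𝒟 → U ++ D ∈ 𝒞 ×ᶜ 𝒟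
∈-×ᶜ⁺ U∈ D∈ = ∈-concatMap⁺ _ (lose U∈ (∈-concatMap⁺ _ (lose D∈ (here refl))))

∈-×ᶜ⁻ : ∀ {C} 𝒞 𝒟 → C ∈ 𝒞 ×ᶜ 𝒟 → ∃₂ λ U D → U ∈ 𝒞 × D ∈ 𝒟 × C ≡ U ++ D
∈-×ᶜ⁻ 𝒞 𝒟 C∈
  with U , U∈ , C∈′ ← find (∈-concatMap⁻ (λ U → concatMap (λ D → [ U ++ D ]) 𝒟) C∈)
  with D , D∈ , here C≡ ← find (∈-concatMap⁻ (λ D → [ U ++ D ]) C∈′)
  = U , D , U∈ , D∈ , C≡

++⁺ : ∀ {U U′ D D′ : Clause} → U′ ⊆ U → D′ ⊆ D → U′ ++ D′ ⊆ U ++ D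
++⁺ {U} {U′} U′⊆U D′⊆D z∈ =
  [ ∈-++⁺ˡ ∘ U′⊆U , ∈-++⁺ʳ U ∘ D′⊆D ]′ (∈-++⁻ U′ z∈)

∨-mono : ∀ {A A′ B B′} → A ⊑ A′ → B ⊑ B′ → A ∨ᴸ B ⊑ A′ ∨ᴸ B′
∨-mono {A} {A′} {B} {B′} (⊑-intro A⊑A′) (⊑-intro B⊑B′) = ⊑-intro bound
  where
  bound : Subsumes (CNF (A′ ∨ᴸ B′)) (CNF (A ∨ᴸ B))
  bound _ C∈ with U , D , U∈ , D∈ , refl ← ∈-×ᶜ⁻ (CNF A) (CNF B) C∈ =
    let U′ , U′∈ , U′⊆U = A⊑A′ U U∈
        D′ , D′∈ , D′⊆D = B⊑B′ D D∈
    in U′ ++ D′ , ∈-×ᶜ⁺ U′∈ D′∈ , ++⁺ U′⊆U D′⊆D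

∨-∧-distribʳ : ∀ {A B D} → (A ∧ᴸ D) ∨ᴸ (B ∧ᴸ D) ⊑ (A ∨ᴸ B) ∧ᴸ D
∨-∧-distribʳ {A} {B} {D} = ⊑-intro bound
  where
  bound : Subsumes (CNF ((A ∨ᴸ B) ∧ᴸ D)) (CNF ((A ∧ᴸ D) ∨ᴸ (B ∧ᴸ D)))
  bound _ C∈ with U , V , U∈ , V∈ , refl ← ∈-×ᶜ⁻ (CNF A ++ CNF D) (CNF B ++ CNF D) C∈
                with ∈-++⁻ (CNF A) U∈ | ∈-++⁻ (CNF B) V∈
  ... | inj₁ U∈A | inj₁ V∈B = U ++ V , ∈-++⁺ˡ (∈-×ᶜ⁺ U∈A V∈B) , λ z → z
  ... | inj₂ U∈D | _        = U , ∈-++⁺ʳ (CNF A ×ᶜ CNF B) U∈D , ∈-++⁺ˡ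
  ... | inj₁ _   | inj₂ V∈D = V , ∈-++⁺ʳ (CNF A ×ᶜ CNF B) V∈D , ∈-++⁺ʳ U

binM-mono : ∀ k {A A′ B B′} → A ⊑ A′ → B ⊑ B′ → binM k A B ⊑ binM k A′ B′
binM-mono L = ∨-mono
binM-mono R = ∧-mono

binM-∧-distribʳ : ∀ k {A B D} → binM k (A ∧ᴸ D) (B ∧ᴸ D) ⊑ binM k A B ∧ᴸ D
binM-∧-distribʳ L = ∨-∧-distribʳ
binM-∧-distribʳ R = ∧-lub (∧-mono ∧-upperˡ ⊑-refl) (∧-mono ∧-upperʳ ⊑-refl)

binM-∧-distribˡ : ∀ k {A B D} → binM k (D ∧ᴸ A) (D ∧ᴸ B) ⊑ D ∧ᴸ binM k A B
binM-∧-distribˡ k = ⊑-trans (binM-mono k ∧-comm ∧-comm) (⊑-trans (binM-∧-distribʳ k) ∧-comm)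

-- rr marks an occurrence all of whose axiom ancestors are of type R/R.
data Mark : Set where
  plain rr : Mark

_≟ᵐ_ : DecidableEquality Mark
plain ≟ᵐ plain = yes refl
rr ≟ᵐ rr = yes refl
plain ≟ᵐ rr = no λ ()
rr ≟ᵐ plain = no λ ()

MEntry : Set
MEntry = Entry × Mark

MSeq : Set
MSeq = List MEntry

_≟ᴹ_ : DecidableEquality MEntry
_≟ᴹ_ = ≡-dec _≟ᵉ_ _≟ᵐ_

AxiomMarks : Part → Part → Mark → Mark → Set
AxiomMarks k k′ plain plain = ⊤
AxiomMarks k k′ rr plain = k ≡ R × k′ ≡ R
AxiomMarks k k′ plain rr = k ≡ R × k′ ≡ R
AxiomMarks k k′ rr rr = ⊥

data MProof : MSeq → Set where
  ax   : (k k′ : Part) (p : ℕ) (m m′ : Mark) → AxiomMarks k k′ m m′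
       → MProof ((en k ante (var p) , m) ∷ (en k′ succ (var p) , m′) ∷ [])
  ax⊥  : (k : Part) → MProof ((en k ante ⊥' , plain) ∷ [])
  wk   : ∀ {Γ} e → MProof Γ → MProof (e ∷ Γ)
  ctr  : ∀ {Γ e} → MProof (e ∷ e ∷ Γ) → MProof (e ∷ Γ)
  perm : ∀ {Γ Δ} → Γ ↭ Δ → MProof Γ → MProof Δ
  L∧₁  : ∀ {Γ} k A B m → MProof ((en k ante A , m) ∷ Γ)
       → MProof ((en k ante (A ∧' B) , m) ∷ Γ)
  L∧₂  : ∀ {Γ} k A B m → MProof ((en k ante B , m) ∷ Γ)
       → MProof ((en k ante (A ∧' B) , m) ∷ Γ)
  R∧   : ∀ {Γ} k A B m → MProof ((en k succ A , m) ∷ Γ) → MProof ((en k succ B , m) ∷ Γ)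
       → MProof ((en k succ (A ∧' B) , m) ∷ Γ)
  R∨₁  : ∀ {Γ} k A B m → MProof ((en k succ A , m) ∷ Γ)
       → MProof ((en k succ (A ∨' B) , m) ∷ Γ)
  R∨₂  : ∀ {Γ} k A B m → MProof ((en k succ B , m) ∷ Γ)
       → MProof ((en k succ (A ∨' B) , m) ∷ Γ)
  L∨   : ∀ {Γ} k A B m → MProof ((en k ante A , m) ∷ Γ) → MProof ((en k ante B , m) ∷ Γ)
       → MProof ((en k ante (A ∨' B) , m) ∷ Γ)
  L¬   : ∀ {Γ} k A m → MProof ((en k succ A , m) ∷ Γ) → MProof ((en k ante (¬' A) , m) ∷ Γ)
  R¬   : ∀ {Γ} k A m → MProof ((en k ante A , m) ∷ Γ) → MProof ((en k succ (¬' A) , m) ∷ Γ)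

interp : ∀ {Γ} → MProof Γ → LF
interp (ax k k′ p _ _ _) = Maehara (Proof.ax k k′ p)
interp (ax⊥ k) = Maehara (Proof.ax⊥ k)
interp (wk _ ρ) = interp ρ
interp (ctr ρ) = interp ρ
interp (perm _ ρ) = interp ρ
interp (L∧₁ _ _ _ _ ρ) = interp ρ
interp (L∧₂ _ _ _ _ ρ) = interp ρ
interp (R∧ k _ _ _ ρ ρ′) = binM k (interp ρ) (interp ρ′)
interp (R∨₁ _ _ _ _ ρ) = interp ρ
interp (R∨₂ _ _ _ _ ρ) = interp ρ
interp (L∨ k _ _ _ ρ ρ′) = binM k (interp ρ) (interp ρ′)
interp (L¬ _ _ _ ρ) = interp ρ
interp (R¬ _ _ _ ρ) = interp ρ

CutFreeProof : Seq → LF → Set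
CutFreeProof Γ M = Σ (Proof Γ) λ π → CutFree π × Maehara π ≡ M

castCutFree : ∀ {Γ Δ M} → Γ ≡ Δ → CutFreeProof Γ M → CutFreeProof Δ M
castCutFree {M = M} = subst (λ Ψ → CutFreeProof Ψ M)

permute : ∀ Φ {Γ Δ M} → Γ ↭ Δ → CutFreeProof (Φ ++ Γ) M → CutFreeProof (Φ ++ Δ) M
permute Φ refl π = π
permute Φ {x ∷ Γ} {_ ∷ Δ} (prep x p) π =
  castCutFree (++-assoc Φ [ x ] Δ)
    (permute (Φ ++ [ x ]) p (castCutFree (sym (++-assoc Φ [ x ] Γ)) π))
permute Φ {x ∷ y ∷ Γ} {_ ∷ _ ∷ Δ} (swap x y p) π =
  let π′ , cf , eq = castCutFree (++-assoc Φ (x ∷ y ∷ []) Δ)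
                       (permute (Φ ++ x ∷ y ∷ []) p
                         (castCutFree (sym (++-assoc Φ (x ∷ y ∷ []) Γ)) π))
  in exch Φ y x Δ π′ , cf , eq
permute Φ (trans p q) π = permute Φ q (permute Φ p π)

erase : ∀ {Γ} (ρ : MProof Γ) → CutFreeProof (map proj₁ Γ) (interp ρ)
erase (ax k k′ p _ _ _) = Proof.ax k k′ p , tt , refl
erase (ax⊥ k) = Proof.ax⊥ k , tt , refl
erase (wk e ρ) = let π , cf , eq = erase ρ in Proof.wk (proj₁ e) π , cf , eq
erase (ctr ρ) = let π , cf , eq = erase ρ in Proof.ctr π , cf , eq
erase (perm p ρ) = permute [] (map⁺ proj₁ p) (erase ρ)
erase (L∧₁ k A B _ ρ) = let π , cf , eq = erase ρ in Proof.L∧₁ k A B π , cf , eq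
erase (L∧₂ k A B _ ρ) = let π , cf , eq = erase ρ in Proof.L∧₂ k A B π , cf , eq
erase (R∧ k A B _ ρ ρ′) =
  let π , cf , eq = erase ρ ; π′ , cf′ , eq′ = erase ρ′
  in Proof.R∧ k A B π π′ , (cf , cf′) , cong₂ (binM k) eq eq′
erase (R∨₁ k A B _ ρ) = let π , cf , eq = erase ρ in Proof.R∨₁ k A B π , cf , eq
erase (R∨₂ k A B _ ρ) = let π , cf , eq = erase ρ in Proof.R∨₂ k A B π , cf , eq
erase (L∨ k A B _ ρ ρ′) =
  let π , cf , eq = erase ρ ; π′ , cf′ , eq′ = erase ρ′
  in Proof.L∨ k A B π π′ , (cf , cf′) , cong₂ (binM k) eq eq′
erase (L¬ k A _ ρ) = let π , cf , eq = erase ρ in Proof.L¬ k A π , cf , eq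
erase (R¬ k A _ ρ) = let π , cf , eq = erase ρ in Proof.R¬ k A π , cf , eq

Bounded : MSeq → LF → Set
Bounded Θ M = Σ (MProof Θ) λ ρ → interp ρ ⊑ M

⊑-bound : ∀ {Θ M M′} → Bounded Θ M → M ⊑ M′ → Bounded Θ M′
⊑-bound (ρ , b) M⊑M′ = ρ , ⊑-trans b M⊑M′

∈⇒↭∷ : ∀ {x : MEntry} {Γ} → x ∈ Γ → Σ MSeq λ Γ′ → Γ ↭ x ∷ Γ′
∈⇒↭∷ {x} x∈ with Φ , Ψ , refl ← ∈-∃++ x∈ = Φ ++ Ψ , shift x Φ Ψ

contract : ∀ {x Γ M} → x ∈ Γ → Bounded (x ∷ Γ) M → Bounded Γ M
contract {x} x∈ (ρ , b) with Γ′ , p ← ∈⇒↭∷ x∈ = perm (↭-sym p) (ctr (perm (prep x p) ρ)) , b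

contract* : ∀ Δ {Θ M} → Δ ⊆ Θ → Bounded (Δ ++ Θ) M → Bounded Θ M
contract* [] _ ρ = ρ
contract* (x ∷ Δ) Δ⊆Θ ρ =
  contract* Δ (Δ⊆Θ ∘ there) (contract (∈-++⁺ʳ Δ (Δ⊆Θ (here refl))) ρ)

weaken* : ∀ Θ {Δ M} → Bounded Δ M → Bounded (Θ ++ Δ) M
weaken* [] ρ = ρ
weaken* (x ∷ Θ) ρ = let ρ′ , b = weaken* Θ ρ in wk x ρ′ , b

⊆-admissible : ∀ {Δ Θ M} → Δ ⊆ Θ → Bounded Δ M → Bounded Θ M
⊆-admissible {Δ} {Θ} Δ⊆Θ ρ =
  let ρ′ , b = weaken* Θ ρ in contract* Δ Δ⊆Θ (perm (++-comm Θ Δ) ρ′ , b)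

rule₁ : ∀ {a e Θ M} (r : MProof (a ∷ Θ) → MProof (e ∷ Θ)) → (∀ ρ → interp (r ρ) ≡ interp ρ)
      → e ∈ Θ → Bounded (a ∷ Θ) M → Bounded Θ M
rule₁ r r-interp e∈ (ρ , b) = contract e∈ (r ρ , subst (_⊑ _) (sym (r-interp ρ)) b)

rule₂ : ∀ k {a b e Θ M M′ N} (r : MProof (a ∷ Θ) → MProof (b ∷ Θ) → MProof (e ∷ Θ))
      → (∀ ρ ρ′ → interp (r ρ ρ′) ≡ binM k (interp ρ) (interp ρ′))
      → e ∈ Θ → binM k M M′ ⊑ N → Bounded (a ∷ Θ) M → Bounded (b ∷ Θ) M′ → Bounded Θ N
rule₂ k r r-interp e∈ bound (ρ , b) (ρ′ , b′) =
  contract e∈ (r ρ ρ′ , subst (_⊑ _) (sym (r-interp ρ ρ′)) (⊑-trans (binM-mono k b b′) bound))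

cutSucc cutAnte : Fm → Mark → MEntry
cutSucc A m = en R succ A , m
cutAnte A m = en R ante A , m

_∖_⊆_ : MSeq → MEntry → MSeq → Set
Γ ∖ x ⊆ Θ = ∀ {z} → z ∈ Γ → z ≢ x → z ∈ Θ

∖⊆-antimono : ∀ {Γ Γ′ x Θ} → Γ ⊆ Γ′ → Γ′ ∖ x ⊆ Θ → Γ ∖ x ⊆ Θ
∖⊆-antimono Γ⊆Γ′ h z∈ = h (Γ⊆Γ′ z∈)

∖⊆-∷ : ∀ {a Γ x Θ} → Γ ∖ x ⊆ Θ → (a ∷ Γ) ∖ x ⊆ (a ∷ Θ)
∖⊆-∷ h (here refl) _ = here refl
∖⊆-∷ h (there z∈) ≢x = there (h z∈ ≢x)

∖⊆-∷-replace : ∀ {a e Γ x Θ} → (e ∷ Γ) ∖ x ⊆ Θ → (a ∷ Γ) ∖ x ⊆ (a ∷ Θ)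
∖⊆-∷-replace h = ∖⊆-∷ (∖⊆-antimono there h)

∖⊆-∷ʳ : ∀ {a Γ x Θ} → Γ ∖ x ⊆ Θ → Γ ∖ x ⊆ (a ∷ Θ)
∖⊆-∷ʳ h z∈ ≢x = there (h z∈ ≢x)

∷∖⊆ : ∀ {x Θ} → (x ∷ Θ) ∖ x ⊆ Θ
∷∖⊆ (here refl) ≢x = ⊥-elim (≢x refl)
∷∖⊆ (there z∈) _ = z∈

data OneMarked : Mark → Mark → Set where
  markedˡ : ∀ {m} → OneMarked rr m
  markedʳ : ∀ {m} → OneMarked m rr

OneMarked-sym : ∀ {m₁ m₂} → OneMarked m₁ m₂ → OneMarked m₂ m₁
OneMarked-sym markedˡ = markedʳ
OneMarked-sym markedʳ = markedˡ

-- A mix removes every occurrence of the cut formula from both premises at once; the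
-- bound M ∧ interp ρ₂ is the Maehara interpolant of the corresponding type-R cut.
CutsAgainst : Mark → Mark → Fm → MSeq → LF → Set
CutsAgainst m₁ m₂ A Γ M =
  ∀ {Π} (ρ₂ : MProof Π) Θ → Γ ∖ cutSucc A m₁ ⊆ Θ → Π ∖ cutAnte A m₂ ⊆ Θ
  → Bounded Θ (M ∧ᴸ interp ρ₂)

-- A left premise whose last rule introduces the cut formula A; the premises of that rule
-- may still contain A, so they are only known through their mixes.
data Principal (m₁ m₂ : Mark) : Fm → MSeq → LF → Set where
  ax  : ∀ k p m → AxiomMarks k R m m₁
      → Principal m₁ m₂ (var p) [ en k ante (var p) , m ] (Maehara (Proof.ax k R p))
  R∧  : ∀ {Γ B B′ M M′}
      → CutsAgainst m₁ m₂ (B ∧' B′) (cutSucc B m₁ ∷ Γ) M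
      → CutsAgainst m₁ m₂ (B ∧' B′) (cutSucc B′ m₁ ∷ Γ) M′
      → Principal m₁ m₂ (B ∧' B′) Γ (M ∧ᴸ M′)
  R∨₁ : ∀ {Γ B B′ M}
      → CutsAgainst m₁ m₂ (B ∨' B′) (cutSucc B m₁ ∷ Γ) M → Principal m₁ m₂ (B ∨' B′) Γ M
  R∨₂ : ∀ {Γ B B′ M}
      → CutsAgainst m₁ m₂ (B ∨' B′) (cutSucc B′ m₁ ∷ Γ) M → Principal m₁ m₂ (B ∨' B′) Γ M
  R¬  : ∀ {Γ B M}
      → CutsAgainst m₁ m₂ (¬' B) (cutAnte B m₁ ∷ Γ) M → Principal m₁ m₂ (¬' B) Γ M

axiom-cut-marks : ∀ {k k′ m m₁ m₂ m′} → OneMarked m₁ m₂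
                → AxiomMarks k R m m₁ → AxiomMarks R k′ m₂ m′ → AxiomMarks k k′ m m′
axiom-cut-marks {m = plain} {m′ = plain} _ _ _ = tt
axiom-cut-marks {m = plain} {m₂ = plain} {m′ = rr} markedˡ (refl , _) (_ , k′≡R) = refl , k′≡R
axiom-cut-marks {m = rr} {m₁ = plain} {m′ = plain} markedʳ (k≡R , _) (_ , k′≡R) = k≡R , k′≡R
axiom-cut-marks {m = rr} {m₁ = rr} markedˡ () _
axiom-cut-marks {m = plain} {m₁ = plain} {m′ = rr} markedʳ _ ()
axiom-cut-marks {m = plain} {m₂ = rr} {m′ = rr} _ _ ()
axiom-cut-marks {m = rr} {m₁ = plain} {m′ = rr} markedʳ _ ()

-- The marked axiom is ;p ⇒ ;p, whose interpolant ⊤ leaves the other one as the bound.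
axiom-cut-interp : ∀ {k k′ m m₁ m₂ m′ p} → OneMarked m₁ m₂
                 → AxiomMarks k R m m₁ → AxiomMarks R k′ m₂ m′
                 → Maehara (Proof.ax k k′ p) ⊑ Maehara (Proof.ax k R p) ∧ᴸ Maehara (Proof.ax R k′ p)
axiom-cut-interp {m = plain} markedˡ (refl , _) _ = ∧-upperʳ
axiom-cut-interp {m = rr} markedˡ () _
axiom-cut-interp {m′ = plain} markedʳ _ (_ , refl) = ∧-upperˡ
axiom-cut-interp {m′ = rr} markedʳ _ ()

-- Recursion is on the cut formula, then on the left premise (mix-left) or on the right
-- premise (mix-right).
mutual
  cut-admissible : ∀ A {m₁ m₂ Θ M₁ M₂} → OneMarked m₁ m₂
                 → Bounded (cutSucc A m₁ ∷ Θ) M₁ → Bounded (cutAnte A m₂ ∷ Θ) M₂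
                 → Bounded Θ (M₁ ∧ᴸ M₂)
  cut-admissible A one (ρ₁ , b₁) (ρ₂ , b₂) =
    ⊑-bound (mix-left A one ρ₁ ρ₂ _ ∷∖⊆ ∷∖⊆) (∧-mono b₁ b₂)

  mix-left : ∀ A {m₁ m₂} → OneMarked m₁ m₂ → ∀ {Γ} (ρ₁ : MProof Γ)
           → CutsAgainst m₁ m₂ A Γ (interp ρ₁)
  mix-left A {m₁} one (ax k k′ p m m′ ok) ρ₂ Θ h₁ h₂
    with (en k′ succ (var p) , m′) ≟ᴹ cutSucc A m₁
  ... | yes refl =
    mix-right (var p) one (ax k p m ok) ρ₂ Θ (∖⊆-antimono (λ { (here refl) → here refl }) h₁) h₂
  ... | no ≢A =
    ⊆-admissible (λ { (here refl) → h₁ (here refl) (λ ())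
                    ; (there (here refl)) → h₁ (there (here refl)) ≢A })
                 (ax k k′ p m m′ ok , ∧-upperˡ)
  mix-left A one (ax⊥ k) ρ₂ Θ h₁ h₂ =
    ⊆-admissible (λ { (here refl) → h₁ (here refl) (λ ()) }) (ax⊥ k , ∧-upperˡ)
  mix-left A one (wk e ρ) ρ₂ Θ h₁ h₂ = mix-left A one ρ ρ₂ Θ (∖⊆-antimono there h₁) h₂
  mix-left A one (ctr ρ) ρ₂ Θ h₁ h₂ =
    mix-left A one ρ ρ₂ Θ (∖⊆-antimono (λ { (here refl) → here refl ; (there z∈) → z∈ }) h₁) h₂
  mix-left A one (perm p ρ) ρ₂ Θ h₁ h₂ = mix-left A one ρ ρ₂ Θ (∖⊆-antimono (∈-resp-↭ p) h₁) h₂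
  mix-left A one (L∧₁ k B B′ m ρ) ρ₂ Θ h₁ h₂ =
    rule₁ (L∧₁ k B B′ m) (λ _ → refl) (h₁ (here refl) λ ())
      (mix-left A one ρ ρ₂ _ (∖⊆-∷-replace h₁) (∖⊆-∷ʳ h₂))
  mix-left A one (L∧₂ k B B′ m ρ) ρ₂ Θ h₁ h₂ =
    rule₁ (L∧₂ k B B′ m) (λ _ → refl) (h₁ (here refl) λ ())
      (mix-left A one ρ ρ₂ _ (∖⊆-∷-replace h₁) (∖⊆-∷ʳ h₂))
  mix-left A one (L¬ k B m ρ) ρ₂ Θ h₁ h₂ =
    rule₁ (L¬ k B m) (λ _ → refl) (h₁ (here refl) λ ())
      (mix-left A one ρ ρ₂ _ (∖⊆-∷-replace h₁) (∖⊆-∷ʳ h₂))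
  mix-left A one (L∨ k B B′ m ρ ρ′) ρ₂ Θ h₁ h₂ =
    rule₂ k (L∨ k B B′ m) (λ _ _ → refl) (h₁ (here refl) λ ()) (binM-∧-distribʳ k)
      (mix-left A one ρ ρ₂ _ (∖⊆-∷-replace h₁) (∖⊆-∷ʳ h₂))
      (mix-left A one ρ′ ρ₂ _ (∖⊆-∷-replace h₁) (∖⊆-∷ʳ h₂))
  mix-left A {m₁} one (R∧ k B B′ m ρ ρ′) ρ₂ Θ h₁ h₂
    with (en k succ (B ∧' B′) , m) ≟ᴹ cutSucc A m₁
  ... | yes refl =
    mix-right A one (R∧ (mix-left A one ρ) (mix-left A one ρ′)) ρ₂ Θ (∖⊆-antimono there h₁) h₂
  ... | no ≢A =
    rule₂ k (R∧ k B B′ m) (λ _ _ → refl) (h₁ (here refl) ≢A) (binM-∧-distribʳ k)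
      (mix-left A one ρ ρ₂ _ (∖⊆-∷-replace h₁) (∖⊆-∷ʳ h₂))
      (mix-left A one ρ′ ρ₂ _ (∖⊆-∷-replace h₁) (∖⊆-∷ʳ h₂))
  mix-left A {m₁} one (R∨₁ k B B′ m ρ) ρ₂ Θ h₁ h₂
    with (en k succ (B ∨' B′) , m) ≟ᴹ cutSucc A m₁
  ... | yes refl = mix-right A one (R∨₁ (mix-left A one ρ)) ρ₂ Θ (∖⊆-antimono there h₁) h₂
  ... | no ≢A =
    rule₁ (R∨₁ k B B′ m) (λ _ → refl) (h₁ (here refl) ≢A)
      (mix-left A one ρ ρ₂ _ (∖⊆-∷-replace h₁) (∖⊆-∷ʳ h₂))
  mix-left A {m₁} one (R∨₂ k B B′ m ρ) ρ₂ Θ h₁ h₂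
    with (en k succ (B ∨' B′) , m) ≟ᴹ cutSucc A m₁
  ... | yes refl = mix-right A one (R∨₂ (mix-left A one ρ)) ρ₂ Θ (∖⊆-antimono there h₁) h₂
  ... | no ≢A =
    rule₁ (R∨₂ k B B′ m) (λ _ → refl) (h₁ (here refl) ≢A)
      (mix-left A one ρ ρ₂ _ (∖⊆-∷-replace h₁) (∖⊆-∷ʳ h₂))
  mix-left A {m₁} one (R¬ k B m ρ) ρ₂ Θ h₁ h₂
    with (en k succ (¬' B) , m) ≟ᴹ cutSucc A m₁
  ... | yes refl = mix-right A one (R¬ (mix-left A one ρ)) ρ₂ Θ (∖⊆-antimono there h₁) h₂
  ... | no ≢A =
    rule₁ (R¬ k B m) (λ _ → refl) (h₁ (here refl) ≢A)
      (mix-left A one ρ ρ₂ _ (∖⊆-∷-replace h₁) (∖⊆-∷ʳ h₂))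

  mix-right : ∀ A {m₁ m₂} → OneMarked m₁ m₂ → ∀ {Γ M} → Principal m₁ m₂ A Γ M
            → CutsAgainst m₁ m₂ A Γ M
  mix-right A {m₂ = m₂} one P (ax k k′ p m m′ ok) Θ h₁ h₂
    with (en k ante (var p) , m) ≟ᴹ cutAnte A m₂
  mix-right _ one (ax k₀ p m₀ ok₀) (ax _ k′ p m m′ ok) Θ h₁ h₂ | yes refl =
    ⊆-admissible (λ { (here refl) → h₁ (here refl) (λ ())
                    ; (there (here refl)) → h₂ (there (here refl)) (λ ()) })
                 (ax k₀ k′ p m₀ m′ (axiom-cut-marks one ok₀ ok) , axiom-cut-interp one ok₀ ok)
  ... | no ≢A =
    ⊆-admissible (λ { (here refl) → h₂ (here refl) ≢A
                    ; (there (here refl)) → h₂ (there (here refl)) (λ ()) })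
                 (ax k k′ p m m′ ok , ∧-upperʳ)
  mix-right A {m₂ = m₂} one P (ax⊥ k) Θ h₁ h₂ with (en k ante ⊥' , plain) ≟ᴹ cutAnte A m₂
  mix-right _ one () (ax⊥ k) Θ h₁ h₂ | yes refl
  ... | no ≢A = ⊆-admissible (λ { (here refl) → h₂ (here refl) ≢A }) (ax⊥ k , ∧-upperʳ)
  mix-right A one P (wk e ρ) Θ h₁ h₂ = mix-right A one P ρ Θ h₁ (∖⊆-antimono there h₂)
  mix-right A one P (ctr ρ) Θ h₁ h₂ =
    mix-right A one P ρ Θ h₁ (∖⊆-antimono (λ { (here refl) → here refl ; (there z∈) → z∈ }) h₂)
  mix-right A one P (perm p ρ) Θ h₁ h₂ = mix-right A one P ρ Θ h₁ (∖⊆-antimono (∈-resp-↭ p) h₂)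
  mix-right A one P (R∧ k B B′ m ρ ρ′) Θ h₁ h₂ =
    rule₂ k (R∧ k B B′ m) (λ _ _ → refl) (h₂ (here refl) λ ()) (binM-∧-distribˡ k)
      (mix-right A one P ρ _ (∖⊆-∷ʳ h₁) (∖⊆-∷-replace h₂))
      (mix-right A one P ρ′ _ (∖⊆-∷ʳ h₁) (∖⊆-∷-replace h₂))
  mix-right A one P (R∨₁ k B B′ m ρ) Θ h₁ h₂ =
    rule₁ (R∨₁ k B B′ m) (λ _ → refl) (h₂ (here refl) λ ())
      (mix-right A one P ρ _ (∖⊆-∷ʳ h₁) (∖⊆-∷-replace h₂))
  mix-right A one P (R∨₂ k B B′ m ρ) Θ h₁ h₂ =
    rule₁ (R∨₂ k B B′ m) (λ _ → refl) (h₂ (here refl) λ ())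
      (mix-right A one P ρ _ (∖⊆-∷ʳ h₁) (∖⊆-∷-replace h₂))
  mix-right A one P (R¬ k B m ρ) Θ h₁ h₂ =
    rule₁ (R¬ k B m) (λ _ → refl) (h₂ (here refl) λ ())
      (mix-right A one P ρ _ (∖⊆-∷ʳ h₁) (∖⊆-∷-replace h₂))
  mix-right A {m₂ = m₂} one P (L∧₁ k B B′ m ρ) Θ h₁ h₂
    with (en k ante (B ∧' B′) , m) ≟ᴹ cutAnte A m₂
  mix-right _ one P@(R∧ mixB _) (L∧₁ _ B B′ _ ρ) Θ h₁ h₂ | yes refl =
    ⊑-bound (cut-admissible B one (mixB (L∧₁ R B B′ _ ρ) _ (∖⊆-∷ h₁) (∖⊆-∷ʳ h₂))
                                  (mix-right (B ∧' B′) one P ρ _ (∖⊆-∷ʳ h₁) (∖⊆-∷-replace h₂)))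
            (∧-lub (∧-mono ∧-upperˡ ⊑-refl) ⊑-refl)
  ... | no ≢A =
    rule₁ (L∧₁ k B B′ m) (λ _ → refl) (h₂ (here refl) ≢A)
      (mix-right A one P ρ _ (∖⊆-∷ʳ h₁) (∖⊆-∷-replace h₂))
  mix-right A {m₂ = m₂} one P (L∧₂ k B B′ m ρ) Θ h₁ h₂
    with (en k ante (B ∧' B′) , m) ≟ᴹ cutAnte A m₂
  mix-right _ one P@(R∧ _ mixB′) (L∧₂ _ B B′ _ ρ) Θ h₁ h₂ | yes refl =
    ⊑-bound (cut-admissible B′ one (mixB′ (L∧₂ R B B′ _ ρ) _ (∖⊆-∷ h₁) (∖⊆-∷ʳ h₂))
                                   (mix-right (B ∧' B′) one P ρ _ (∖⊆-∷ʳ h₁) (∖⊆-∷-replace h₂)))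
            (∧-lub (∧-mono ∧-upperʳ ⊑-refl) ⊑-refl)
  ... | no ≢A =
    rule₁ (L∧₂ k B B′ m) (λ _ → refl) (h₂ (here refl) ≢A)
      (mix-right A one P ρ _ (∖⊆-∷ʳ h₁) (∖⊆-∷-replace h₂))
  mix-right A {m₂ = m₂} one P (L¬ k B m ρ) Θ h₁ h₂
    with (en k ante (¬' B) , m) ≟ᴹ cutAnte A m₂
  mix-right _ one P@(R¬ mixB) (L¬ _ B _ ρ) Θ h₁ h₂ | yes refl =
    ⊑-bound (cut-admissible B (OneMarked-sym one)
               (mix-right (¬' B) one P ρ _ (∖⊆-∷ʳ h₁) (∖⊆-∷-replace h₂))
               (mixB (L¬ R B _ ρ) _ (∖⊆-∷ h₁) (∖⊆-∷ʳ h₂)))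
            (∧-lub ⊑-refl ⊑-refl)
  ... | no ≢A =
    rule₁ (L¬ k B m) (λ _ → refl) (h₂ (here refl) ≢A)
      (mix-right A one P ρ _ (∖⊆-∷ʳ h₁) (∖⊆-∷-replace h₂))
  mix-right A {m₂ = m₂} one P (L∨ k B B′ m ρ ρ′) Θ h₁ h₂
    with (en k ante (B ∨' B′) , m) ≟ᴹ cutAnte A m₂
  mix-right _ one P@(R∨₁ mixB) (L∨ _ B B′ _ ρ ρ′) Θ h₁ h₂ | yes refl =
    ⊑-bound (cut-admissible B one (mixB (L∨ R B B′ _ ρ ρ′) _ (∖⊆-∷ h₁) (∖⊆-∷ʳ h₂))
                                  (mix-right (B ∨' B′) one P ρ _ (∖⊆-∷ʳ h₁) (∖⊆-∷-replace h₂)))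
            (∧-lub ⊑-refl (∧-mono ⊑-refl ∧-upperˡ))
  mix-right _ one P@(R∨₂ mixB′) (L∨ _ B B′ _ ρ ρ′) Θ h₁ h₂ | yes refl =
    ⊑-bound (cut-admissible B′ one (mixB′ (L∨ R B B′ _ ρ ρ′) _ (∖⊆-∷ h₁) (∖⊆-∷ʳ h₂))
                                   (mix-right (B ∨' B′) one P ρ′ _ (∖⊆-∷ʳ h₁) (∖⊆-∷-replace h₂)))
            (∧-lub ⊑-refl (∧-mono ⊑-refl ∧-upperʳ))
  ... | no ≢A =
    rule₂ k (L∨ k B B′ m) (λ _ _ → refl) (h₂ (here refl) ≢A) (binM-∧-distribˡ k)
      (mix-right A one P ρ _ (∖⊆-∷ʳ h₁) (∖⊆-∷-replace h₂))
      (mix-right A one P ρ′ _ (∖⊆-∷ʳ h₁) (∖⊆-∷-replace h₂))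

Marking : Set
Marking = ℕ → Mark

_◂_ : Mark → Marking → Marking
(m ◂ ℓ) zero = m
(m ◂ ℓ) (suc i) = ℓ i

contractIx : ℕ → ℕ
contractIx zero = zero
contractIx (suc zero) = zero
contractIx (suc (suc i)) = suc i

mark : Seq → Marking → MSeq
mark [] ℓ = []
mark (e ∷ Γ) ℓ = (e , ℓ 0) ∷ mark Γ (ℓ ∘ suc)

map-proj₁-mark : ∀ Γ ℓ → map proj₁ (mark Γ ℓ) ≡ Γ
map-proj₁-mark [] ℓ = refl
map-proj₁-mark (e ∷ Γ) ℓ = cong (e ∷_) (map-proj₁-mark Γ (ℓ ∘ suc))

mark-exch : ∀ Γ e f Δ ℓ
          → mark (Γ ++ f ∷ e ∷ Δ) (ℓ ∘ swapIx (length Γ)) ↭ mark (Γ ++ e ∷ f ∷ Δ) ℓ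
mark-exch [] e f Δ ℓ = swap _ _ refl
mark-exch (g ∷ Γ) e f Δ ℓ = prep _ (mark-exch Γ e f Δ (ℓ ∘ suc))

Consistent : ∀ {Γ} → Proof Γ → Marking → Set
Consistent (Proof.ax k k′ p) ℓ = AxiomMarks k k′ (ℓ 0) (ℓ 1)
Consistent (Proof.ax⊥ k) ℓ = ℓ 0 ≡ plain
Consistent (Proof.wk e π) ℓ = Consistent π (ℓ ∘ suc)
Consistent (Proof.ctr π) ℓ = Consistent π (ℓ ∘ contractIx)
Consistent (exch Γ e f Δ π) ℓ = Consistent π (ℓ ∘ swapIx (length Γ))
Consistent (Proof.L∧₁ k A B π) ℓ = Consistent π ℓ
Consistent (Proof.L∧₂ k A B π) ℓ = Consistent π ℓ
Consistent (Proof.R∧ k A B π π′) ℓ = Consistent π ℓ × Consistent π′ ℓ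
Consistent (Proof.R∨₁ k A B π) ℓ = Consistent π ℓ
Consistent (Proof.R∨₂ k A B π) ℓ = Consistent π ℓ
Consistent (Proof.L∨ k A B π π′) ℓ = Consistent π ℓ × Consistent π′ ℓ
Consistent (Proof.L¬ k A π) ℓ = Consistent π ℓ
Consistent (Proof.R¬ k A π) ℓ = Consistent π ℓ
Consistent (Proof.cut k A π π′) ℓ = Consistent π (rr ◂ ℓ) × Consistent π′ (plain ◂ ℓ)
                                  ⊎ Consistent π (plain ◂ ℓ) × Consistent π′ (rr ◂ ℓ)

eliminate-cuts : ∀ {Γ} (π : Proof Γ) ℓ → Consistent π ℓ → AllCutsTypeR π
               → Bounded (mark Γ ℓ) (Maehara π)
eliminate-cuts (Proof.ax k k′ p) ℓ c _ = ax k k′ p (ℓ 0) (ℓ 1) c , ⊑-refl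
eliminate-cuts (Proof.ax⊥ k) ℓ c _ rewrite c = ax⊥ k , ⊑-refl
eliminate-cuts (Proof.wk e π) ℓ c t =
  let ρ , b = eliminate-cuts π (ℓ ∘ suc) c t in wk _ ρ , b
eliminate-cuts (Proof.ctr π) ℓ c t =
  let ρ , b = eliminate-cuts π (ℓ ∘ contractIx) c t in ctr ρ , b
eliminate-cuts (exch Γ e f Δ π) ℓ c t =
  let ρ , b = eliminate-cuts π (ℓ ∘ swapIx (length Γ)) c t in perm (mark-exch Γ e f Δ ℓ) ρ , b
eliminate-cuts (Proof.L∧₁ k A B π) ℓ c t =
  let ρ , b = eliminate-cuts π ℓ c t in L∧₁ k A B _ ρ , b
eliminate-cuts (Proof.L∧₂ k A B π) ℓ c t =
  let ρ , b = eliminate-cuts π ℓ c t in L∧₂ k A B _ ρ , b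
eliminate-cuts (Proof.R∧ k A B π π′) ℓ (c , c′) (t , t′) =
  let ρ , b = eliminate-cuts π ℓ c t ; ρ′ , b′ = eliminate-cuts π′ ℓ c′ t′
  in R∧ k A B _ ρ ρ′ , binM-mono k b b′
eliminate-cuts (Proof.R∨₁ k A B π) ℓ c t =
  let ρ , b = eliminate-cuts π ℓ c t in R∨₁ k A B _ ρ , b
eliminate-cuts (Proof.R∨₂ k A B π) ℓ c t =
  let ρ , b = eliminate-cuts π ℓ c t in R∨₂ k A B _ ρ , b
eliminate-cuts (Proof.L∨ k A B π π′) ℓ (c , c′) (t , t′) =
  let ρ , b = eliminate-cuts π ℓ c t ; ρ′ , b′ = eliminate-cuts π′ ℓ c′ t′
  in L∨ k A B _ ρ ρ′ , binM-mono k b b′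
eliminate-cuts (Proof.L¬ k A π) ℓ c t =
  let ρ , b = eliminate-cuts π ℓ c t in L¬ k A _ ρ , b
eliminate-cuts (Proof.R¬ k A π) ℓ c t =
  let ρ , b = eliminate-cuts π ℓ c t in R¬ k A _ ρ , b
eliminate-cuts (Proof.cut k A π π′) ℓ (inj₁ (c , c′)) (refl , t , t′) =
  cut-admissible A markedˡ (eliminate-cuts π (rr ◂ ℓ) c t) (eliminate-cuts π′ (plain ◂ ℓ) c′ t′)
eliminate-cuts (Proof.cut k A π π′) ℓ (inj₂ (c , c′)) (refl , t , t′) =
  cut-admissible A markedʳ (eliminate-cuts π (plain ◂ ℓ) c t) (eliminate-cuts π′ (rr ◂ ℓ) c′ t′)

-- Index 0 of an axiom occurrence is its antecedent formula, index 1 its succedent formula.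
data OtherEnd : ℕ → ℕ → Set where
  ante→succ : OtherEnd 0 1
  succ→ante : OtherEnd 1 0

OtherEnd-sym : ∀ {j j′} → OtherEnd j j′ → OtherEnd j′ j
OtherEnd-sym ante→succ = succ→ante
OtherEnd-sym succ→ante = ante→succ

bothEnds : ∀ {P : ℕ → Set} {j j′} → OtherEnd j j′ → P j → P j′ → P 0 × P 1
bothEnds ante→succ p q = p , q
bothEnds succ→ante p q = q , p

IsRR⇒R/R : ∀ {k k′ p} → IsRR (varAx k k′ p) → k ≡ R × k′ ≡ R
IsRR⇒R/R {R} {R} _ = refl , refl

IsRR⇒IsVarAx : ∀ {x} → IsRR x → IsVarAx x
IsRR⇒IsVarAx {varAx _ _ _} _ = tt

WellMarkedLeaves : {X : Set} → (X → Leaf) → (ℕ → X → ℕ → Set) → (X → ℕ → Set)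
                 → Marking → Set
WellMarkedLeaves leaf anc cutAnc ℓ =
  ∀ a i {j j′} → OtherEnd j j′ → anc i a j → ℓ i ≡ rr
  → IsRR (leaf a) × (∀ i′ → anc i′ a j′ → ℓ i′ ≡ plain) × ¬ cutAnc a j′

WellMarked : ∀ {Γ} → Proof Γ → Marking → Set
WellMarked π = WellMarkedLeaves (axAt π) (Anc π) (CutAnc π)

NoΩ : ∀ {Γ} → Proof Γ → Set
NoΩ π = ∀ a → ¬ TypeΩ π a

-- What CutAnc, NoΩ and WellMarked of a cut say about its premise π, whose occurrence 0
-- is the cut formula.
CutAnc⁺ : ∀ {Γ} (π : Proof Γ) → AxPos π → ℕ → Set
CutAnc⁺ π a j = Anc π 0 a j ⊎ CutAnc π a j

NoΩ⁺ : ∀ {Γ} → Proof Γ → Set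
NoΩ⁺ π = ∀ a → ¬ (IsVarAx (axAt π a) × CutAnc⁺ π a 0 × CutAnc⁺ π a 1)

WellMarked⁺ : ∀ {Γ} → Proof Γ → Marking → Set
WellMarked⁺ π = WellMarkedLeaves (axAt π) (Anc π ∘ suc) (CutAnc⁺ π)

NoΩ⁺⇒NoΩ : ∀ {Γ} {π : Proof Γ} → NoΩ⁺ π → NoΩ π
NoΩ⁺⇒NoΩ noΩ a (isVar , c₀ , c₁) = noΩ a (isVar , inj₂ c₀ , inj₂ c₁)

wellMarked-reindex : ∀ {X} {leaf : X → Leaf} {anc anc′ cutAnc ℓ} (τ : ℕ → ℕ)
                   → (∀ i {a j} → anc i a j → anc′ (τ i) a j)
                   → WellMarkedLeaves leaf anc′ cutAnc ℓ → WellMarkedLeaves leaf anc cutAnc (ℓ ∘ τ)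
wellMarked-reindex τ lift wm a i o an eq =
  let isRR , others , noCut = wm a (τ i) o (lift i an) eq
  in isRR , (λ i′ an′ → others (τ i′) (lift i′ an′)) , noCut

wellMarked-plain : ∀ {Γ} {π : Proof Γ} {ℓ} → WellMarked⁺ π ℓ → WellMarked π (plain ◂ ℓ)
wellMarked-plain wm a zero o an ()
wellMarked-plain wm a (suc i) o an eq =
  let isRR , others , noCut = wm a i o an eq
  in isRR , (λ { zero _ → refl ; (suc i′) an′ → others i′ an′ }) , noCut ∘ inj₂

wellMarked-rr : ∀ {Γ} {π : Proof Γ} {ℓ} → NoΩ⁺ π → CutFmRR π → WellMarked⁺ π ℓ
              → WellMarked π (rr ◂ ℓ)
wellMarked-rr {π = π} {ℓ} noΩ allRR wm a zero {j} {j′} o an₀ _ = isRR , others , notBoth ∘ inj₂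
  where
  isRR = allRR a j an₀

  notBoth : ¬ CutAnc⁺ π a j′
  notBoth c = noΩ a (IsRR⇒IsVarAx isRR , bothEnds {P = CutAnc⁺ π a} o (inj₁ an₀) c)

  others : ∀ i′ → Anc π i′ a j′ → (rr ◂ ℓ) i′ ≡ plain
  others zero an = ⊥-elim (notBoth (inj₁ an))
  others (suc i′) an with ℓ i′ in eq
  ... | plain = refl
  ... | rr = ⊥-elim (proj₂ (proj₂ (wm a i′ (OtherEnd-sym o) an eq)) (inj₁ an₀))
wellMarked-rr noΩ allRR wm a (suc i) o an eq =
  let isRR , others , noCut = wm a i o an eq
  in isRR , (λ { zero an′ → ⊥-elim (noCut (inj₁ an′)) ; (suc i′) an′ → others i′ an′ })
          , noCut ∘ inj₂

wk-ancestor : ∀ {Γ e} {π : Proof Γ} i {a j} → Anc π i a j → Anc (Proof.wk e π) (suc i) a j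
wk-ancestor i an = an

ctr-ancestor : ∀ {Γ e} {π : Proof (e ∷ e ∷ Γ)} i {a j}
             → Anc π i a j → Anc (Proof.ctr π) (contractIx i) a j
ctr-ancestor zero = inj₁
ctr-ancestor (suc zero) = inj₂
ctr-ancestor (suc (suc i)) an = an

swapIx-involutive : ∀ n i → swapIx n (swapIx n i) ≡ i
swapIx-involutive zero zero = refl
swapIx-involutive zero (suc zero) = refl
swapIx-involutive zero (suc (suc i)) = refl
swapIx-involutive (suc n) zero = refl
swapIx-involutive (suc n) (suc i) = cong suc (swapIx-involutive n i)

exch-ancestor : ∀ Γ {e f Δ} {π : Proof (Γ ++ f ∷ e ∷ Δ)} i {a j}
              → Anc π i a j → Anc (exch Γ e f Δ π) (swapIx (length Γ) i) a j
exch-ancestor Γ {π = π} i {a} {j} = subst (λ i′ → Anc π i′ a j) (sym (swapIx-involutive (length Γ) i))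

OneCutPremiseRR : CutPred
OneCutPremiseRR _ _ π π′ = CutFmRR π ⊎ CutFmRR π′

wellMarked⇒consistent : ∀ {Γ} (π : Proof Γ) ℓ → NoΩ π → AllCuts OneCutPremiseRR π
                      → WellMarked π ℓ → Consistent π ℓ
wellMarked⇒consistent (Proof.ax k k′ p) ℓ _ _ wm with ℓ 0 in eq₀ | ℓ 1 in eq₁
... | plain | plain = tt
... | rr | plain = IsRR⇒R/R (proj₁ (wm tt 0 ante→succ refl eq₀))
... | plain | rr = IsRR⇒R/R (proj₁ (wm tt 1 succ→ante refl eq₁))
... | rr | rr with () ← subst (_≡ plain) eq₁ (proj₁ (proj₂ (wm tt 0 ante→succ refl eq₀)) 1 refl)
wellMarked⇒consistent (Proof.ax⊥ k) ℓ _ _ wm with ℓ 0 in eq₀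
... | plain = refl
... | rr = ⊥-elim (proj₁ (wm tt 0 ante→succ refl eq₀))
wellMarked⇒consistent (Proof.wk e π) ℓ noΩ cuts wm =
  wellMarked⇒consistent π (ℓ ∘ suc) noΩ cuts (wellMarked-reindex suc (wk-ancestor {e = e} {π = π}) wm)
wellMarked⇒consistent (Proof.ctr π) ℓ noΩ cuts wm =
  wellMarked⇒consistent π (ℓ ∘ contractIx) noΩ cuts (wellMarked-reindex contractIx ctr-ancestor wm)
wellMarked⇒consistent (exch Γ e f Δ π) ℓ noΩ cuts wm =
  wellMarked⇒consistent π (ℓ ∘ swapIx (length Γ)) noΩ cuts
    (wellMarked-reindex (swapIx (length Γ)) (exch-ancestor Γ {π = π}) wm)
wellMarked⇒consistent (Proof.L∧₁ k A B π) ℓ noΩ cuts wm = wellMarked⇒consistent π ℓ noΩ cuts wm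
wellMarked⇒consistent (Proof.L∧₂ k A B π) ℓ noΩ cuts wm = wellMarked⇒consistent π ℓ noΩ cuts wm
wellMarked⇒consistent (Proof.R∧ k A B π π′) ℓ noΩ (cuts , cuts′) wm =
  wellMarked⇒consistent π ℓ (noΩ ∘ inj₁) cuts (wm ∘ inj₁) ,
  wellMarked⇒consistent π′ ℓ (noΩ ∘ inj₂) cuts′ (wm ∘ inj₂)
wellMarked⇒consistent (Proof.R∨₁ k A B π) ℓ noΩ cuts wm = wellMarked⇒consistent π ℓ noΩ cuts wm
wellMarked⇒consistent (Proof.R∨₂ k A B π) ℓ noΩ cuts wm = wellMarked⇒consistent π ℓ noΩ cuts wm
wellMarked⇒consistent (Proof.L∨ k A B π π′) ℓ noΩ (cuts , cuts′) wm =
  wellMarked⇒consistent π ℓ (noΩ ∘ inj₁) cuts (wm ∘ inj₁) ,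
  wellMarked⇒consistent π′ ℓ (noΩ ∘ inj₂) cuts′ (wm ∘ inj₂)
wellMarked⇒consistent (Proof.L¬ k A π) ℓ noΩ cuts wm = wellMarked⇒consistent π ℓ noΩ cuts wm
wellMarked⇒consistent (Proof.R¬ k A π) ℓ noΩ cuts wm = wellMarked⇒consistent π ℓ noΩ cuts wm
wellMarked⇒consistent (Proof.cut k A π π′) ℓ noΩ (inj₁ allRR , cuts , cuts′) wm =
  inj₁ ( wellMarked⇒consistent π (rr ◂ ℓ) (NoΩ⁺⇒NoΩ {π = π} (noΩ ∘ inj₁)) cuts
           (wellMarked-rr {π = π} (noΩ ∘ inj₁) allRR (wm ∘ inj₁))
       , wellMarked⇒consistent π′ (plain ◂ ℓ) (NoΩ⁺⇒NoΩ {π = π′} (noΩ ∘ inj₂)) cuts′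
           (wellMarked-plain {π = π′} (wm ∘ inj₂)) )
wellMarked⇒consistent (Proof.cut k A π π′) ℓ noΩ (inj₂ allRR , cuts , cuts′) wm =
  inj₂ ( wellMarked⇒consistent π (plain ◂ ℓ) (NoΩ⁺⇒NoΩ {π = π} (noΩ ∘ inj₁)) cuts
           (wellMarked-plain {π = π} (wm ∘ inj₁))
       , wellMarked⇒consistent π′ (rr ◂ ℓ) (NoΩ⁺⇒NoΩ {π = π′} (noΩ ∘ inj₂)) cuts′
           (wellMarked-rr {π = π′} (noΩ ∘ inj₂) allRR (wm ∘ inj₂)) )

lemma5p9 : (S : Seq) (π : Proof S)
    → IsLKm π → Tame π → AllCutsTypeR π
    → Σ (Proof S) (λ π′ → CutFree π′ × Subsumes (CNF (Maehara π)) (CNF (Maehara π′)))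
lemma5p9 S π _ (noΩ , cuts) typeR =
  let unmarked = λ _ → plain
      consistent = wellMarked⇒consistent π unmarked noΩ cuts λ _ _ _ _ ()
      ρ , bound = eliminate-cuts π unmarked consistent typeR
      π′ , cutFree , interp≡ = castCutFree (map-proj₁-mark S unmarked) (erase ρ)
  in π′ , cutFree , subsumes (subst (_⊑ Maehara π) (sym interp≡) bound)
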